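{- Let $E$ be a finite set and $f:2^E\to\mathbb{R}_+$ a monotone submodular function. Suppose that for all distinct $i,j\in E$ we are given real numbers $A_{ij}=A_{ji}$ with $\mathrm{Hess}_f(X)_{ij}\le A_{ij}\le 0$ for every $X\subseteq E\setminus\{i,j\}$. Set $A_{ii}:=2f(i\mid E-i)-2\sum_{k\neq i}A_{ik}$ for $i\in E$. Then the resulting symmetric matrix $A\in\mathbb{R}^{E\times E}$ satisfies \[ \sum_{k\in X}A_{ik}+\tfrac12 A_{ii}\le f(i\mid X)\quad\text{for all } i\in E,\ X\subseteq E\setminus\{i\}, \] and \[ \mathbf{1}_X^\top A\mathbf{1}_X\ge 0\quad\text{for all } X\subseteq E. \]
   Context: For $i\in E$ and $X\subseteq E$, $f(i\mid X):=f(X\cup\{i\})-f(X)$, and $E-i:=E\setminus\{i\}$. The discrete Hessian of $f$ at $X$ is the matrix $\mathrm{Hess}_f(X)\in\mathbb{R}^{E\times E}$ with $\mathrm{Hess}_f(X)_{ij}=f(X\cup\{i,j\})+f(X)-f(X\cup\{i\})-f(X\cup\{j\})$. $\mathbf{1}_X$ is the characteristic vector of $X$. -}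

module Defs where

open import Level using (Level; _⊔_) renaming (suc to lsuc)
open import Algebra.Bundles using (CommutativeRing)
open import Relation.Binary.Core using (Rel)
open import Relation.Binary.Structures using (IsTotalOrder)
open import Relation.Nullary using (¬_; yes; no)
open import Data.Nat using (ℕ; zero; suc)
open import Data.Fin using (Fin; zero; suc; _≟_)
open import Data.Fin.Subset using (Subset; _∈_; _∉_; _⊆_; _∪_; _∩_; ∁; ⁅_⁆; inside; outside)
open import Data.Vec using (lookup)
open import Data.Bool using (Bool; true; false)
open import Relation.Binary.PropositionalEquality using (_≢_)

-- An ordered field (the real numbers ℝ are one).  The statement is proved
-- for every ordered field, in particular for ℝ.
record OrderedField (c ℓ₁ ℓ₂ : Level) : Set (lsuc (c ⊔ ℓ₁ ⊔ ℓ₂)) where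
  field
    commutativeRing : CommutativeRing c ℓ₁
  open CommutativeRing commutativeRing public
  field
    _≤_          : Rel Carrier ℓ₂
    isTotalOrder : IsTotalOrder _≈_ _≤_
    +-mono-≤     : ∀ z {x y} → x ≤ y → (x + z) ≤ (y + z)
    *-nonneg     : ∀ {x y} → 0# ≤ x → 0# ≤ y → 0# ≤ (x * y)
    0≉1          : ¬ (0# ≈ 1#)
    inv          : Carrier → Carrier
    inv-inverse  : ∀ x → ¬ (x ≈ 0#) → (x * inv x) ≈ 1#

  ½ : Carrier
  ½ = inv (1# + 1#)

module SetFunctions {c ℓ₁ ℓ₂} (F : OrderedField c ℓ₁ ℓ₂) where
  open OrderedField F using (Carrier; _≈_; _≤_; _+_; _*_; _-_; 0#; 1#)

  sumAll : ∀ {n} → (Fin n → Carrier) → Carrier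
  sumAll {zero}  g = 0#
  sumAll {suc n} g = g zero + sumAll (λ k → g (suc k))

  sumIn : ∀ {n} → Subset n → (Fin n → Carrier) → Carrier
  sumIn X g = sumAll (λ k → ifIn (lookup X k) (g k))
    where
    ifIn : Bool → Carrier → Carrier
    ifIn true  x = x
    ifIn false x = 0#

  sumExcept : ∀ {n} → Fin n → (Fin n → Carrier) → Carrier
  sumExcept i g = sumAll (λ k → h k)
    where
    h : _ → Carrier
    h k with k ≟ i
    ... | yes _ = 0#
    ... | no  _ = g k

  Monotone : ∀ {n} → (Subset n → Carrier) → Set _
  Monotone f = ∀ {X Y} → X ⊆ Y → f X ≤ f Y

  Submodular : ∀ {n} → (Subset n → Carrier) → Set _
  Submodular f = ∀ X Y → (f (X ∪ Y) + f (X ∩ Y)) ≤ (f X + f Y)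

  NonNegative : ∀ {n} → (Subset n → Carrier) → Set _
  NonNegative f = ∀ X → 0# ≤ f X

  marginal : ∀ {n} → (Subset n → Carrier) → Fin n → Subset n → Carrier
  marginal f i X = f (X ∪ ⁅ i ⁆) - f X

  hess : ∀ {n} → (Subset n → Carrier) → Subset n → Fin n → Fin n → Carrier
  hess f X i j = ((f (X ∪ (⁅ i ⁆ ∪ ⁅ j ⁆)) + f X) - f (X ∪ ⁅ i ⁆)) - f (X ∪ ⁅ j ⁆)

  fullMatrix : ∀ {n} → (Subset n → Carrier) → (Fin n → Fin n → Carrier) → Fin n → Fin n → Carrier
  fullMatrix f A' i j with i ≟ j
  ... | yes _ = ((1# + 1#) * marginal f i (∁ ⁅ i ⁆)) - ((1# + 1#) * sumExcept i (A' i))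
  ... | no  _ = A' i j

  quadForm : ∀ {n} → (Fin n → Fin n → Carrier) → Subset n → Carrier
  quadForm M X = sumIn X (λ i → sumIn X (λ k → M i k))

-- Fix i and let g = f(i | ·). The increment g(Z ∪ {k}) − g(Z) is the Hessian entry Hess_f(Z)_ik,
-- hence at most A_ik, so telescoping from X up to E − i gives
-- f(i | E − i) − f(i | X) ≤ Σ_{k ∈ E−i, k ∉ X} A_ik; since ½ A_ii = f(i | E − i) − Σ_{k≠i} A_ik,
-- this is the first inequality. For the second, the off-diagonal entries are nonpositive, so for
-- i ∈ X the sum of row i over X is at least the full row sum A_ii + Σ_{k≠i} A_ik
-- = 2 f(i | E − i) − Σ_{k≠i} A_ik, which is nonnegative by monotonicity; now sum over i ∈ X.
module Submission where

open import Defs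
open import Data.Nat as ℕ using (ℕ)
open import Data.Fin using (Fin; zero; suc; _≟_)
open import Data.Fin.Subset using (Subset; _⊆_; _∪_; ∁; ⁅_⁆; _∈_; _∉_; ⊤; ⊥)
open import Data.Fin.Subset.Properties
  using ( drop-there; drop-∷-⊆; s⊆s; out⊆; ⊆-refl; p⊆p∪q; ∪-assoc; ∪-comm; ∪-identityʳ
        ; ⊆⊤; x∈p∪q⁻; x∈⁅y⁆⇒x≡y; x∈∁p⇒x∉p; x∉p⇒x∈∁p; x∉⁅y⁆⇒x≢y; x≢y⇒x∉⁅y⁆)
open import Data.Vec using (_∷_; []; here; there)
open import Data.Vec.Properties using (map-replicate)
open import Data.Bool using (true; false; not)
open import Data.Bool.Properties using (∨-identityʳ)
open import Function using (_∘_)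
open import Data.Product using (_×_; _,_; proj₁; proj₂)
open import Relation.Binary.PropositionalEquality as ≡ using (_≡_; _≢_; ≢-sym)

open import Relation.Binary.Bundles using (Poset)
open import Relation.Binary.Structures using (IsTotalOrder)
import Relation.Binary.Reasoning.PartialOrder
open import Relation.Nullary using (¬_; yes; no; contradiction)
open import Data.Sum using (inj₁; inj₂; [_,_]′)

module OrderedFieldProperties {c ℓ₁ ℓ₂} (F : OrderedField c ℓ₁ ℓ₂) where
  open OrderedField F public hiding (zero)
  open import Algebra.Properties.CommutativeSemigroup +-commutativeSemigroup public
    using (x∙yz≈y∙xz; xy∙z≈y∙xz; x∙yz≈yx∙z)
  open import Algebra.Properties.Group +-group public using (//-rightDividesˡ; //-rightDividesʳ)
  open import Algebra.Properties.Ring ring public using (x[y-z]≈xy-xz)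
  open import Algebra.Properties.Ring ring using (-1*x≈-x; -‿involutive)

  open IsTotalOrder isTotalOrder public
    using (total; antisym)
    renaming (refl to ≤-refl; trans to ≤-trans; ≤-respˡ-≈ to ≤-respˡ; ≤-respʳ-≈ to ≤-respʳ)

  poset : Poset c ℓ₁ ℓ₂
  poset = record { isPartialOrder = IsTotalOrder.isPartialOrder isTotalOrder }

  module ≤-Reasoning = Relation.Binary.Reasoning.PartialOrder poset

  +-monoˡ-≤ : ∀ z {x y} → x ≤ y → (z + x) ≤ (z + y)
  +-monoˡ-≤ z {x} {y} x≤y = ≤-respˡ (+-comm x z) (≤-respʳ (+-comm y z) (+-mono-≤ z x≤y))

  +-mono : ∀ {x y u v} → x ≤ y → u ≤ v → (x + u) ≤ (y + v)
  +-mono {y = y} {u} x≤y u≤v = ≤-trans (+-mono-≤ u x≤y) (+-monoˡ-≤ y u≤v)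

  x≤y⇒0≤y-x : ∀ {x y} → x ≤ y → 0# ≤ (y - x)
  x≤y⇒0≤y-x {x} {y} x≤y = ≤-respˡ (-‿inverseʳ x) (+-mono-≤ (- x) x≤y)

  x≤0⇒0≤-x : ∀ {x} → x ≤ 0# → 0# ≤ (- x)
  x≤0⇒0≤-x {x} x≤0 = ≤-respʳ (+-identityˡ (- x)) (x≤y⇒0≤y-x x≤0)

  x+u≤y+v⇒x+[w+u]≤y+[w+v] : ∀ {x y u v} w → (x + u) ≤ (y + v) → (x + (w + u)) ≤ (y + (w + v))
  x+u≤y+v⇒x+[w+u]≤y+[w+v] {x} {y} {u} {v} w x+u≤y+v = begin
    x + (w + u)  ≈⟨ x∙yz≈y∙xz x w u ⟩
    w + (x + u)  ≤⟨ +-monoˡ-≤ w x+u≤y+v ⟩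
    w + (y + v)  ≈⟨ x∙yz≈y∙xz w y v ⟩
    y + (w + v)  ∎
    where open ≤-Reasoning

  x+u≤y+v⇒u+[x-v]≤y : ∀ {x y u v} → (x + u) ≤ (y + v) → (u + (x - v)) ≤ y
  x+u≤y+v⇒u+[x-v]≤y {x} {y} {u} {v} x+u≤y+v = begin
    u + (x - v)    ≈⟨ x∙yz≈yx∙z u x (- v) ⟩
    (x + u) - v    ≤⟨ +-mono-≤ (- v) x+u≤y+v ⟩
    (y + v) - v    ≈⟨ //-rightDividesʳ v y ⟩
    y              ∎
    where open ≤-Reasoning

  0≤1 : 0# ≤ 1#
  0≤1 with total 0# 1#
  ... | inj₁ 0≤1 = 0≤1
  ... | inj₂ 1≤0 = ≤-respʳ [-1]*[-1]≈1 (*-nonneg 0≤-1 0≤-1)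
    where
    0≤-1 : 0# ≤ (- 1#)
    0≤-1 = x≤0⇒0≤-x 1≤0
    [-1]*[-1]≈1 : ((- 1#) * (- 1#)) ≈ 1#
    [-1]*[-1]≈1 = trans (-1*x≈-x (- 1#)) (-‿involutive 1#)

  1≤1+1 : 1# ≤ (1# + 1#)
  1≤1+1 = ≤-respˡ (+-identityˡ 1#) (+-mono-≤ 1# 0≤1)

  0≤1+1 : 0# ≤ (1# + 1#)
  0≤1+1 = ≤-trans 0≤1 1≤1+1

  1+1≉0 : ¬ ((1# + 1#) ≈ 0#)
  1+1≉0 2≈0 = 0≉1 (antisym 0≤1 (≤-respʳ 2≈0 1≤1+1))

  ½*[2*x]≈x : ∀ x → (½ * ((1# + 1#) * x)) ≈ x
  ½*[2*x]≈x x = begin-equality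
    ½ * ((1# + 1#) * x)  ≈⟨ *-assoc ½ (1# + 1#) x ⟨
    (½ * (1# + 1#)) * x  ≈⟨ *-congʳ (trans (*-comm ½ (1# + 1#)) (inv-inverse (1# + 1#) 1+1≉0)) ⟩
    1# * x               ≈⟨ *-identityˡ x ⟩
    x                    ∎
    where open ≤-Reasoning

  x≤0⇒[1+1]*x≤x : ∀ {x} → x ≤ 0# → ((1# + 1#) * x) ≤ x
  x≤0⇒[1+1]*x≤x {x} x≤0 = begin
    (1# + 1#) * x     ≈⟨ distribʳ x 1# 1# ⟩
    1# * x + 1# * x   ≈⟨ +-cong (*-identityˡ x) (*-identityˡ x) ⟩
    x + x             ≤⟨ +-mono-≤ x x≤0 ⟩
    0# + x            ≈⟨ +-identityˡ x ⟩
    x                 ∎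
    where open ≤-Reasoning

module SumProperties {c ℓ₁ ℓ₂} (F : OrderedField c ℓ₁ ℓ₂) where
  open OrderedFieldProperties F
  open SetFunctions F

  sumIn-cong : ∀ {n} (X : Subset n) {g h : Fin n → Carrier} →
               (∀ {k} → k ∈ X → g k ≈ h k) → sumIn X g ≈ sumIn X h
  sumIn-cong []          g≈h = refl
  sumIn-cong (true ∷ X)  g≈h = +-cong (g≈h here) (sumIn-cong X (g≈h ∘ there))
  sumIn-cong (false ∷ X) g≈h = +-congˡ (sumIn-cong X (g≈h ∘ there))

  sumIn-mono : ∀ {n} (X : Subset n) {g h : Fin n → Carrier} →
               (∀ {k} → k ∈ X → g k ≤ h k) → sumIn X g ≤ sumIn X h
  sumIn-mono []          g≤h = ≤-refl
  sumIn-mono (true ∷ X)  g≤h = +-mono (g≤h here) (sumIn-mono X (g≤h ∘ there))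
  sumIn-mono (false ∷ X) g≤h = +-monoˡ-≤ 0# (sumIn-mono X (g≤h ∘ there))

  sumIn-0 : ∀ {n} (X : Subset n) → sumIn X (λ _ → 0#) ≈ 0#
  sumIn-0 []          = refl
  sumIn-0 (true ∷ X)  = trans (+-identityˡ _) (sumIn-0 X)
  sumIn-0 (false ∷ X) = trans (+-identityˡ _) (sumIn-0 X)

  sumIn-nonneg : ∀ {n} (X : Subset n) {g : Fin n → Carrier} →
                 (∀ {k} → k ∈ X → 0# ≤ g k) → 0# ≤ sumIn X g
  sumIn-nonneg X 0≤g = ≤-respˡ (sumIn-0 X) (sumIn-mono X 0≤g)

  sumIn-nonpos : ∀ {n} (X : Subset n) {g : Fin n → Carrier} →
                 (∀ {k} → k ∈ X → g k ≤ 0#) → sumIn X g ≤ 0#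
  sumIn-nonpos X g≤0 = ≤-respʳ (sumIn-0 X) (sumIn-mono X g≤0)

  sumIn-antitone : ∀ {n} {X Y : Subset n} {g : Fin n → Carrier} → X ⊆ Y →
                   (∀ {k} → k ∈ Y → k ∉ X → g k ≤ 0#) → sumIn Y g ≤ sumIn X g
  sumIn-antitone {X = []}        {[]}        _   _   = ≤-refl
  sumIn-antitone {X = true ∷ X}  {false ∷ Y} X⊆Y _   with () ← X⊆Y here
  sumIn-antitone {X = true ∷ X}  {true ∷ Y}  X⊆Y g≤0 =
    +-monoˡ-≤ _ (sumIn-antitone (drop-∷-⊆ X⊆Y) (λ k∈Y k∉X → g≤0 (there k∈Y) (k∉X ∘ drop-there)))
  sumIn-antitone {X = false ∷ X} {false ∷ Y} X⊆Y g≤0 =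
    +-monoˡ-≤ _ (sumIn-antitone (drop-∷-⊆ X⊆Y) (λ k∈Y k∉X → g≤0 (there k∈Y) (k∉X ∘ drop-there)))
  sumIn-antitone {X = false ∷ X} {true ∷ Y}  X⊆Y g≤0 =
    +-mono (g≤0 here λ ())
           (sumIn-antitone (drop-∷-⊆ X⊆Y) (λ k∈Y k∉X → g≤0 (there k∈Y) (k∉X ∘ drop-there)))

  sumIn-⊤-split : ∀ {n} (i : Fin n) (g : Fin n → Carrier) → sumIn ⊤ g ≈ (g i + sumIn (∁ ⁅ i ⁆) g)
  sumIn-⊤-split {ℕ.suc n} zero g = +-congˡ (begin-equality
    sumIn ⊤ (g ∘ suc)             ≡⟨ ≡.cong (λ Y → sumIn Y (g ∘ suc)) (map-replicate not false n) ⟨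
    sumIn (∁ ⊥) (g ∘ suc)         ≈⟨ +-identityˡ _ ⟨
    0# + sumIn (∁ ⊥) (g ∘ suc)    ∎)
    where open ≤-Reasoning
  sumIn-⊤-split (suc i) g = begin-equality
    g zero + sumIn ⊤ (g ∘ suc)                              ≈⟨ +-congˡ (sumIn-⊤-split i (g ∘ suc)) ⟩
    g zero + (g (suc i) + sumIn (∁ ⁅ i ⁆) (g ∘ suc))        ≈⟨ x∙yz≈y∙xz _ _ _ ⟩
    g (suc i) + (g zero + sumIn (∁ ⁅ i ⁆) (g ∘ suc))        ∎
    where open ≤-Reasoning

  sumAll≈sumIn : ∀ {n} (X : Subset n) {t g : Fin n → Carrier} →
                 (∀ {k} → k ∈ X → t k ≈ g k) → (∀ {k} → k ∉ X → t k ≈ 0#) → sumAll t ≈ sumIn X g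
  sumAll≈sumIn []          _    _     = refl
  sumAll≈sumIn (true ∷ X)  t≈g  t≈0 =
    +-cong (t≈g here) (sumAll≈sumIn X (t≈g ∘ there) (λ k∉X → t≈0 (k∉X ∘ drop-there)))
  sumAll≈sumIn (false ∷ X) t≈g  t≈0 =
    +-cong (t≈0 λ ()) (sumAll≈sumIn X (t≈g ∘ there) (λ k∉X → t≈0 (k∉X ∘ drop-there)))

  -- Defs defines the summand of `sumExcept` in a where block; unifying against `sumAll` names it.
  private
    exceptSummand : ∀ {n} → Fin n → (Fin n → Carrier) → Fin n → Carrier
    exceptSummand i g = summand {s = sumExcept i g} ≡.refl
      where
      summand : ∀ {n s} {t : Fin n → Carrier} → s ≡ sumAll t → Fin n → Carrier
      summand {t = t} _ = t

  sumExcept≈sumIn-∁ : ∀ {n} (i : Fin n) (g : Fin n → Carrier) → sumExcept i g ≈ sumIn (∁ ⁅ i ⁆) g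
  sumExcept≈sumIn-∁ i g = sumAll≈sumIn (∁ ⁅ i ⁆) inside outside
    where
    inside : ∀ {k} → k ∈ ∁ ⁅ i ⁆ → exceptSummand i g k ≈ g k
    inside {k} k∈∁i with k ≟ i
    ... | yes k≡i = contradiction k≡i (x∉⁅y⁆⇒x≢y (x∈∁p⇒x∉p k∈∁i))
    ... | no  _   = refl
    outside : ∀ {k} → k ∉ ∁ ⁅ i ⁆ → exceptSummand i g k ≈ 0#
    outside {k} k∉∁i with k ≟ i
    ... | yes _   = refl
    ... | no  k≢i = contradiction (x∉p⇒x∈∁p (x≢y⇒x∉⁅y⁆ k≢i)) k∉∁i

  GainsBoundedIn : ∀ {n} → Subset n → (Subset n → Carrier) → (Fin n → Carrier) → Set ℓ₂
  GainsBoundedIn Y g a = ∀ {Z k} → Z ⊆ Y → k ∈ Y → k ∉ Z → g (Z ∪ ⁅ k ⁆) ≤ (g Z + a k)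

  gainsBoundedIn-tail : ∀ {n x y} {Y : Subset n} {g : Subset (ℕ.suc n) → Carrier} {a} →
                        (∀ {Z} → Z ⊆ Y → (x ∷ Z) ⊆ (y ∷ Y)) →
                        GainsBoundedIn (y ∷ Y) g a → GainsBoundedIn Y (g ∘ (x ∷_)) (a ∘ suc)
  gainsBoundedIn-tail {x = x} {g = g} {a} ∷⊆∷ gains {Z} {k} Z⊆Y k∈Y k∉Z =
    ≡.subst (λ b → g (b ∷ (Z ∪ ⁅ k ⁆)) ≤ (g (x ∷ Z) + a (suc k))) (∨-identityʳ x)
      (gains (∷⊆∷ Z⊆Y) (there k∈Y) (k∉Z ∘ drop-there))

  telescope : ∀ {n} {X Y : Subset n} {g : Subset n → Carrier} {a : Fin n → Carrier} →
              X ⊆ Y → GainsBoundedIn Y g a → (g Y + sumIn X a) ≤ (g X + sumIn Y a)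
  telescope {X = []}        {[]}                _   _     = ≤-refl
  telescope {X = true ∷ X}  {false ∷ Y}         X⊆Y _     with () ← X⊆Y here
  telescope {X = true ∷ X}  {true ∷ Y}          X⊆Y gains =
    x+u≤y+v⇒x+[w+u]≤y+[w+v] _ (telescope (drop-∷-⊆ X⊆Y) (gainsBoundedIn-tail s⊆s gains))
  telescope {X = false ∷ X} {false ∷ Y}         X⊆Y gains =
    x+u≤y+v⇒x+[w+u]≤y+[w+v] _ (telescope (drop-∷-⊆ X⊆Y) (gainsBoundedIn-tail s⊆s gains))
  telescope {X = false ∷ X} {true ∷ Y} {g} {a} X⊆Y gains = begin
    g (true ∷ Y) + (0# + sumIn X (a ∘ suc))            ≈⟨ +-congˡ (+-identityˡ _) ⟩
    g (true ∷ Y) + sumIn X (a ∘ suc)                   ≤⟨ +-mono-≤ _ gain-at-0 ⟩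
    (g (false ∷ Y) + a zero) + sumIn X (a ∘ suc)       ≈⟨ xy∙z≈y∙xz _ _ _ ⟩
    a zero + (g (false ∷ Y) + sumIn X (a ∘ suc))       ≤⟨ +-monoˡ-≤ _ tail ⟩
    a zero + (g (false ∷ X) + sumIn Y (a ∘ suc))       ≈⟨ x∙yz≈y∙xz _ _ _ ⟩
    g (false ∷ X) + (a zero + sumIn Y (a ∘ suc))       ∎
    where
    open ≤-Reasoning
    tail : (g (false ∷ Y) + sumIn X (a ∘ suc)) ≤ (g (false ∷ X) + sumIn Y (a ∘ suc))
    tail = telescope (drop-∷-⊆ X⊆Y) (gainsBoundedIn-tail out⊆ gains)
    gain-at-0 : g (true ∷ Y) ≤ (g (false ∷ Y) + a zero)
    gain-at-0 = ≡.subst (λ W → g (true ∷ W) ≤ (g (false ∷ Y) + a zero)) (∪-identityʳ Y)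
                  (gains (out⊆ ⊆-refl) here λ ())

module SetFunctionProperties {c ℓ₁ ℓ₂} (F : OrderedField c ℓ₁ ℓ₂) where
  open OrderedFieldProperties F
  open SetFunctions F

  k∈∁⁅i⁆⇒i≢k : ∀ {n} {i k : Fin n} → k ∈ ∁ ⁅ i ⁆ → i ≢ k
  k∈∁⁅i⁆⇒i≢k k∈∁⁅i⁆ = ≢-sym (x∉⁅y⁆⇒x≢y (x∈∁p⇒x∉p k∈∁⁅i⁆))

  marginal-nonneg : ∀ {n} {f : Subset n → Carrier} → Monotone f → ∀ i X → 0# ≤ marginal f i X
  marginal-nonneg mono i X = x≤y⇒0≤y-x (mono (p⊆p∪q ⁅ i ⁆))

  marginal-∪-⁅⁆ : ∀ {n} (f : Subset n → Carrier) i k Z →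
                  marginal f i (Z ∪ ⁅ k ⁆) ≈ (marginal f i Z + hess f Z i k)
  marginal-∪-⁅⁆ f i k Z = begin-equality
    f ((Z ∪ ⁅ k ⁆) ∪ ⁅ i ⁆) - fZk                  ≡⟨ ≡.cong (λ W → f W - fZk) Z∪k∪i≡Z∪[i∪k] ⟩
    fZik - fZk                                      ≈⟨ +-congʳ (//-rightDividesʳ fZ fZik) ⟨
    ((fZik + fZ) - fZ) - fZk                        ≈⟨ +-congʳ (+-congʳ (//-rightDividesˡ fZi (fZik + fZ))) ⟨
    ((((fZik + fZ) - fZi) + fZi) - fZ) - fZk        ≈⟨ +-congʳ (+-assoc _ fZi (- fZ)) ⟩
    (((fZik + fZ) - fZi) + (fZi - fZ)) - fZk        ≈⟨ +-congʳ (+-comm _ (fZi - fZ)) ⟩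
    ((fZi - fZ) + ((fZik + fZ) - fZi)) - fZk        ≈⟨ +-assoc (fZi - fZ) _ (- fZk) ⟩
    (fZi - fZ) + (((fZik + fZ) - fZi) - fZk)        ∎
    where
    open ≤-Reasoning
    fZ fZi fZk fZik : Carrier
    fZ   = f Z
    fZi  = f (Z ∪ ⁅ i ⁆)
    fZk  = f (Z ∪ ⁅ k ⁆)
    fZik = f (Z ∪ (⁅ i ⁆ ∪ ⁅ k ⁆))
    Z∪k∪i≡Z∪[i∪k] : (Z ∪ ⁅ k ⁆) ∪ ⁅ i ⁆ ≡ Z ∪ (⁅ i ⁆ ∪ ⁅ k ⁆)
    Z∪k∪i≡Z∪[i∪k] = ≡.trans (∪-assoc Z ⁅ k ⁆ ⁅ i ⁆) (≡.cong (Z ∪_) (∪-comm ⁅ k ⁆ ⁅ i ⁆))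

  fullMatrix-≢ : ∀ {n} (f : Subset n → Carrier) A' {i j} → i ≢ j → fullMatrix f A' i j ≈ A' i j
  fullMatrix-≢ f A' {i} {j} i≢j with i ≟ j
  ... | yes i≡j = contradiction i≡j i≢j
  ... | no  _   = refl

  fullMatrix-diag : ∀ {n} (f : Subset n → Carrier) A' i →
                    fullMatrix f A' i i
                      ≈ (((1# + 1#) * marginal f i (∁ ⁅ i ⁆)) - ((1# + 1#) * sumExcept i (A' i)))
  fullMatrix-diag f A' i with i ≟ i
  ... | yes _   = refl
  ... | no  i≢i = contradiction ≡.refl i≢i

module Completion {c ℓ₁ ℓ₂} (F : OrderedField c ℓ₁ ℓ₂) where
  open OrderedFieldProperties F
  open SetFunctions F
  open SumProperties F
  open SetFunctionProperties F

  module HessianBounded {n : ℕ} (f : Subset n → Carrier) (A' : Fin n → Fin n → Carrier)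
    (hess≤A' : ∀ {i j} → i ≢ j → ∀ {X} → X ⊆ ∁ (⁅ i ⁆ ∪ ⁅ j ⁆) → hess f X i j ≤ A' i j)
    (A'≤0 : ∀ {i j} → i ≢ j → A' i j ≤ 0#)
    where

    A : Fin n → Fin n → Carrier
    A = fullMatrix f A'

    sumExcept-nonpos : ∀ i → sumExcept i (A' i) ≤ 0#
    sumExcept-nonpos i =
      ≤-respˡ (sym (sumExcept≈sumIn-∁ i (A' i))) (sumIn-nonpos (∁ ⁅ i ⁆) (A'≤0 ∘ k∈∁⁅i⁆⇒i≢k))

    gainsBoundedIn-marginal : ∀ i → GainsBoundedIn (∁ ⁅ i ⁆) (marginal f i) (A' i)
    gainsBoundedIn-marginal i {Z} {k} Z⊆∁⁅i⁆ k∈∁⁅i⁆ k∉Z = begin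
      marginal f i (Z ∪ ⁅ k ⁆)           ≈⟨ marginal-∪-⁅⁆ f i k Z ⟩
      marginal f i Z + hess f Z i k      ≤⟨ +-monoˡ-≤ _ (hess≤A' (k∈∁⁅i⁆⇒i≢k k∈∁⁅i⁆) Z⊆∁[i∪k]) ⟩
      marginal f i Z + A' i k            ∎
      where
      open ≤-Reasoning
      Z⊆∁[i∪k] : Z ⊆ ∁ (⁅ i ⁆ ∪ ⁅ k ⁆)
      Z⊆∁[i∪k] {x} x∈Z = x∉p⇒x∈∁p
        ([ x∈∁p⇒x∉p (Z⊆∁⁅i⁆ x∈Z) , (λ x∈⁅k⁆ → k∉Z (≡.subst (_∈ Z) (x∈⁅y⁆⇒x≡y k x∈⁅k⁆) x∈Z)) ]′
         ∘ x∈p∪q⁻ ⁅ i ⁆ ⁅ k ⁆)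

    half-diagonal : ∀ i → (½ * A i i) ≈ (marginal f i (∁ ⁅ i ⁆) - sumExcept i (A' i))
    half-diagonal i = begin-equality
      ½ * A i i                                 ≈⟨ *-congˡ (fullMatrix-diag f A' i) ⟩
      ½ * ((1# + 1#) * gain - (1# + 1#) * S)    ≈⟨ *-congˡ (x[y-z]≈xy-xz (1# + 1#) gain S) ⟨
      ½ * ((1# + 1#) * (gain - S))              ≈⟨ ½*[2*x]≈x (gain - S) ⟩
      gain - S                                  ∎
      where
      open ≤-Reasoning
      gain S : Carrier
      gain = marginal f i (∁ ⁅ i ⁆)
      S    = sumExcept i (A' i)

    marginal-bound : ∀ i {X} → X ⊆ ∁ ⁅ i ⁆ → (sumIn X (A i) + (½ * A i i)) ≤ marginal f i X
    marginal-bound i {X} X⊆∁⁅i⁆ = begin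
      sumIn X (A i) + ½ * A i i
        ≈⟨ +-cong (sumIn-cong X (fullMatrix-≢ f A' ∘ k∈∁⁅i⁆⇒i≢k ∘ X⊆∁⁅i⁆)) (half-diagonal i) ⟩
      sumIn X (A' i) + (marginal f i (∁ ⁅ i ⁆) - sumExcept i (A' i))
        ≈⟨ +-congˡ (+-congˡ (-‿cong (sumExcept≈sumIn-∁ i (A' i)))) ⟩
      sumIn X (A' i) + (marginal f i (∁ ⁅ i ⁆) - sumIn (∁ ⁅ i ⁆) (A' i))
        ≤⟨ x+u≤y+v⇒u+[x-v]≤y (telescope X⊆∁⁅i⁆ (gainsBoundedIn-marginal i)) ⟩
      marginal f i X
        ∎
      where open ≤-Reasoning

    rowSum-nonneg : Monotone f → ∀ {i X} → i ∈ X → 0# ≤ sumIn X (A i)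
    rowSum-nonneg mono {i} {X} i∈X = begin
      0#                                     ≤⟨ *-nonneg 0≤1+1 (marginal-nonneg mono i (∁ ⁅ i ⁆)) ⟩
      (1# + 1#) * gain                       ≈⟨ //-rightDividesˡ ((1# + 1#) * S) _ ⟨
      ((1# + 1#) * gain - (1# + 1#) * S) + (1# + 1#) * S
                                             ≈⟨ +-congʳ (fullMatrix-diag f A' i) ⟨
      A i i + (1# + 1#) * S                  ≤⟨ +-monoˡ-≤ (A i i) (x≤0⇒[1+1]*x≤x (sumExcept-nonpos i)) ⟩
      A i i + S                              ≈⟨ +-congˡ (sumExcept≈sumIn-∁ i (A' i)) ⟩
      A i i + sumIn (∁ ⁅ i ⁆) (A' i)
        ≈⟨ +-congˡ (sumIn-cong (∁ ⁅ i ⁆) (fullMatrix-≢ f A' ∘ k∈∁⁅i⁆⇒i≢k)) ⟨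
      A i i + sumIn (∁ ⁅ i ⁆) (A i)          ≈⟨ sumIn-⊤-split i (A i) ⟨
      sumIn ⊤ (A i)                          ≤⟨ sumIn-antitone ⊆⊤ offDiagonal-nonpos ⟩
      sumIn X (A i)                          ∎
      where
      open ≤-Reasoning
      gain S : Carrier
      gain = marginal f i (∁ ⁅ i ⁆)
      S    = sumExcept i (A' i)
      offDiagonal-nonpos : ∀ {k} → k ∈ ⊤ → k ∉ X → A i k ≤ 0#
      offDiagonal-nonpos {k} _ k∉X = ≤-respˡ (sym (fullMatrix-≢ f A' i≢k)) (A'≤0 i≢k)
        where
        i≢k : i ≢ k
        i≢k i≡k = k∉X (≡.subst (_∈ X) i≡k i∈X)

    quadForm-nonneg : Monotone f → ∀ X → 0# ≤ quadForm A X
    quadForm-nonneg mono X = sumIn-nonneg X (rowSum-nonneg mono)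

lemma11 : ∀ {c ℓ₁ ℓ₂} (F : OrderedField c ℓ₁ ℓ₂) →
    let open OrderedField F in
    let open SetFunctions F in
    (n : ℕ) (f : Subset n → Carrier) →
    NonNegative f → Monotone f → Submodular f →
    (A' : Fin n → Fin n → Carrier) →
    (∀ i j → i ≢ j → A' i j ≈ A' j i) →
    (∀ i j → i ≢ j → (∀ X → X ⊆ ∁ (⁅ i ⁆ ∪ ⁅ j ⁆) → hess f X i j ≤ A' i j) × (A' i j ≤ 0#)) →
    let A = fullMatrix f A' in
    (∀ i X → X ⊆ ∁ ⁅ i ⁆ → (sumIn X (A i) + (½ * A i i)) ≤ marginal f i X)
    × (∀ X → 0# ≤ quadForm A X)
lemma11 F n f _ mono _ A' _ bounds =
  (λ i _ → marginal-bound i) , quadForm-nonneg mono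
  where
  open Completion.HessianBounded F f A'
    (λ i≢j X⊆∁[i∪j] → proj₁ (bounds _ _ i≢j) _ X⊆∁[i∪j]) (λ i≢j → proj₂ (bounds _ _ i≢j))
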